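{- Let $P$ be a nonempty finite ranked poset of rank at most one, and let $I\in\mathcal{IC}(P)$. Then $\mathrm{Row}(I)=P-I$; consequently rowmotion on $\mathcal{IC}(P)$ has order $2$.
   Context: A subset $I\subseteq P$ is interval-closed if whenever $x,y\in I$ and $x\le z\le y$, then $z\in I$; $\mathcal{IC}(P)$ is the set of interval-closed subsets. For $x\in P$, the toggle $t_x$ sends $I$ to $I\triangle\{x\}$ if this set is interval-closed, and to $I$ otherwise. Rowmotion is $\mathrm{Row}=t_{x_1}\circ\cdots\circ t_{x_N}$ for a linear extension $(x_1,\dots,x_N)$ of $P$ (independent of the choice). The rank of a ranked poset is the largest value of its rank function normalized to have minimum value $0$. The order of a bijection is the least common multiple of its orbit sizes. -}

module Defs where

open import Data.Nat using (ℕ; zero; suc; _<_; _≤_)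
open import Data.Nat.Divisibility using (_∣_)
open import Data.Fin using (Fin)
import Data.Fin
open import Data.Fin.Properties using (all?)
open import Data.Fin.Subset using (Subset; _∈_)
open import Data.Fin.Subset.Properties using (_∈?_)
open import Data.Fin.Permutation using (Permutation′; _⟨$⟩ʳ_)
open import Data.Bool using (not)
open import Data.Vec using (_[_]%=_)
open import Data.List using (List; []; _∷_; map; allFin)
open import Data.Product using (_×_; Σ; ∃; ∃-syntax)
open import Data.Sum using (_⊎_)
open import Relation.Nullary using (¬_; Dec; yes; no)
open import Relation.Nullary.Decidable using (_→-dec_)
open import Relation.Binary using (IsPartialOrder; Decidable)
open import Relation.Binary.PropositionalEquality using (_≡_; _≢_)

-- A finite poset with ground set Fin n; the order relation is decidable
-- (needed to compute toggles).
record FinPoset (n : ℕ) : Set₁ where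
  field
    _≼_            : Fin n → Fin n → Set
    isPartialOrder : IsPartialOrder _≡_ _≼_
    _≼?_           : Decidable _≼_

module _ {n : ℕ} (P : FinPoset n) where
  open FinPoset P

  Covers : Fin n → Fin n → Set
  Covers x y = x ≼ y × x ≢ y × (∀ z → x ≼ z → z ≼ y → z ≡ x ⊎ z ≡ y)

  IsRankFunction : (Fin n → ℕ) → Set
  IsRankFunction r = (∀ x y → Covers x y → r y ≡ suc (r x)) × (∃[ x ] r x ≡ 0)

  RankedOfRankAtMostOne : Set
  RankedOfRankAtMostOne = ∃[ r ] (IsRankFunction r × (∀ x → r x ≤ 1))

  IsIC : Subset n → Set
  IsIC I = ∀ x y z → x ∈ I → y ∈ I → x ≼ z → z ≼ y → z ∈ I

  isIC? : (I : Subset n) → Dec (IsIC I)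
  isIC? I = all? λ x → all? λ y → all? λ z →
    (x ∈? I) →-dec ((y ∈? I) →-dec ((x ≼? z) →-dec ((z ≼? y) →-dec (z ∈? I))))

  flip : Fin n → Subset n → Subset n
  flip x I = I [ x ]%= not

  toggle : Fin n → Subset n → Subset n
  toggle x I with isIC? (flip x I)
  ... | yes _ = flip x I
  ... | no  _ = I

  -- linear extension given as a permutation σ : position ↦ element,
  -- (x₁,…,x_N) = (σ 0, …, σ (N-1)), with x_i < x_j ⇒ i < j
  IsLinearExtension : Permutation′ n → Set
  IsLinearExtension σ = ∀ i j → (σ ⟨$⟩ʳ i) ≼ (σ ⟨$⟩ʳ j) → (σ ⟨$⟩ʳ i) ≢ (σ ⟨$⟩ʳ j)
                          → Data.Fin._<_ i j

  toggleSeq : List (Fin n) → Subset n → Subset n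
  toggleSeq []       I = I
  toggleSeq (y ∷ ys) I = toggle y (toggleSeq ys I)

  Row : Permutation′ n → Subset n → Subset n
  Row σ = toggleSeq (map (σ ⟨$⟩ʳ_) (allFin n))

iter : {A : Set} → ℕ → (A → A) → A → A
iter zero    f a = a
iter (suc k) f a = f (iter k f a)

OrbitSize : {A : Set} → (A → A) → A → ℕ → Set
OrbitSize f a s = 0 < s × iter s f a ≡ a × (∀ j → 0 < j → j < s → iter j f a ≢ a)

-- k is the order of f acting on the elements satisfying D, i.e. the least
-- common multiple of the orbit sizes of those elements
HasOrderOn : {A : Set} → (A → Set) → (A → A) → ℕ → Set
HasOrderOn D f k =
  (∀ a → D a → ∃[ s ] (OrbitSize f a s × s ∣ k)) ×
  (∀ m → (∀ a s → D a → OrbitSize f a s → s ∣ m) → k ∣ m)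

{-# OPTIONS --safe #-}
-- A rank function strictly increases along x < y (split x < y at an element
-- strictly between, or else x is covered by y), so in a poset of rank at most
-- one there is no chain x < y < z.  Then every subset is interval-closed,
-- every toggle merely flips its element, and rowmotion, which toggles each
-- element exactly once, is complementation: an involution without fixed
-- points on a nonempty ground set.
module Submission where

open import Defs
open import Data.Nat using (ℕ; NonZero; suc; _∸_; _<_; s≤s; z≤n)
open import Data.Nat.Properties using (<⇒≤; <⇒≱; <-trans; ≤-<-trans; ≤-trans; ≤-reflexive; ∸-monoˡ-<; ∸-monoʳ-<)
open import Data.Nat.Induction using (<-wellFounded)
open import Data.Nat.Divisibility using (∣-refl)
open import Data.Fin using (Fin; toℕ; _≟_)
open import Data.Fin.Properties using (any?)
open import Data.Fin.Subset using (Subset; ∁; ⊥)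
open import Data.Fin.Subset.Properties using (∪-∩-booleanAlgebra)
open import Data.Fin.Permutation using (Permutation′; _⟨$⟩ʳ_; _⟨$⟩ˡ_; inverseʳ; inverseˡ)
open import Data.Bool using (not)
open import Data.Bool.Properties using (not-¬)
open import Data.Vec using (_∷_; lookup; head; tabulate)
open import Data.Vec.Properties using (lookup∘updateAt; lookup∘updateAt′; lookup-map; tabulate∘lookup; tabulate-cong)
open import Data.List using (List; []; _∷_; map; allFin)
open import Data.List.Membership.Propositional using (_∈_)
open import Data.List.Membership.Propositional.Properties using (∈-allFin; ∈-map⁺)
open import Data.List.Relation.Unary.All as All using (All; _∷_)
open import Data.List.Relation.Unary.Any using (here; there)
open import Data.List.Relation.Unary.AllPairs using (_∷_)
open import Data.List.Relation.Unary.Unique.Propositional using (Unique)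
open import Data.List.Relation.Unary.Unique.Propositional.Properties using (map⁺; allFin⁺)
open import Data.Product using (_×_; _,_; ∃; ∃-syntax)
open import Data.Sum using (_⊎_; inj₁; inj₂)
open import Data.Empty using (⊥-elim)
open import Induction.WellFounded using (Acc; acc)
open import Relation.Nullary using (¬_; Dec; yes; no; ¬?)
open import Relation.Nullary.Decidable using (_×-dec_)
open import Relation.Binary.PropositionalEquality using (_≡_; _≢_; refl; sym; trans; cong; subst; subst₂; module ≡-Reasoning)
open ≡-Reasoning
import Algebra.Lattice.Properties.BooleanAlgebra as BooleanAlgebraProperties

∁-involutive : ∀ {n} (I : Subset n) → ∁ (∁ I) ≡ I
∁-involutive {n} = BooleanAlgebraProperties.¬-involutive (∪-∩-booleanAlgebra n)

∁-fixedPointFree : ∀ {n} .{{_ : NonZero n}} (I : Subset n) → ∁ I ≢ I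
∁-fixedPointFree {suc n} (b ∷ I) ∁I≡I = not-¬ refl (sym (cong head ∁I≡I))

module _ {n : ℕ} (P : FinPoset n) where
  open FinPoset P

  _≺_ : Fin n → Fin n → Set
  x ≺ y = x ≼ y × x ≢ y

  _≺?_ : ∀ x y → Dec (x ≺ y)
  x ≺? y = (x ≼? y) ×-dec ¬? (x ≟ y)

  nothingBetween⇒Covers : ∀ {x y} → x ≺ y → ¬ (∃[ z ] (x ≺ z × z ≺ y)) → Covers P x y
  nothingBetween⇒Covers {x} {y} (x≼y , x≢y) nothing-between =
    x≼y , x≢y , λ z x≼z z≼y → endpoint z x≼z z≼y (z ≟ x) (z ≟ y)
    where
    endpoint : ∀ z → x ≼ z → z ≼ y → Dec (z ≡ x) → Dec (z ≡ y) → z ≡ x ⊎ z ≡ y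
    endpoint z _ _ (yes z≡x) _         = inj₁ z≡x
    endpoint z _ _ (no _)    (yes z≡y) = inj₂ z≡y
    endpoint z x≼z z≼y (no z≢x) (no z≢y) =
      ⊥-elim (nothing-between (z , (x≼z , λ x≡z → z≢x (sym x≡z)) , (z≼y , z≢y)))

  -- The induction is on h y ∸ h x, which drops on both halves of a split x ≺ z ≺ y.
  rank-strictlyMonotone : (h : Fin n → ℕ) → (∀ {x y} → x ≺ y → h x < h y)
    → (r : Fin n → ℕ) → (∀ x y → Covers P x y → r y ≡ suc (r x))
    → ∀ {x y} → x ≺ y → r x < r y
  rank-strictlyMonotone h h-mono r r-cover {x} {y} = go (<-wellFounded (h y ∸ h x))
    where
    go : ∀ {x y} → Acc _<_ (h y ∸ h x) → x ≺ y → r x < r y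
    go {x} {y} (acc smaller) x≺y with any? (λ z → (x ≺? z) ×-dec (z ≺? y))
    ... | no nothing-between = ≤-reflexive (sym (r-cover x y (nothingBetween⇒Covers x≺y nothing-between)))
    ... | yes (z , x≺z , z≺y) =
      <-trans (go (smaller (∸-monoˡ-< (h-mono z≺y) (<⇒≤ (h-mono x≺z)))) x≺z)
              (go (smaller (∸-monoʳ-< (h-mono x≺z) (<⇒≤ (h-mono z≺y)))) z≺y)

  position-strictlyMonotone : (σ : Permutation′ n) → IsLinearExtension P σ
    → ∀ {x y} → x ≺ y → toℕ (σ ⟨$⟩ˡ x) < toℕ (σ ⟨$⟩ˡ y)
  position-strictlyMonotone σ linear {x} {y} (x≼y , x≢y) =
    linear (σ ⟨$⟩ˡ x) (σ ⟨$⟩ˡ y)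
      (subst₂ _≼_ (sym (inverseʳ σ)) (sym (inverseʳ σ)) x≼y)
      (λ σx≡σy → x≢y (trans (sym (inverseʳ σ)) (trans σx≡σy (inverseʳ σ))))

  rankAtMostOne⇒noChain : RankedOfRankAtMostOne P → (σ : Permutation′ n) → IsLinearExtension P σ
    → ∀ {x y z} → x ≺ y → ¬ y ≺ z
  rankAtMostOne⇒noChain (r , (r-cover , _) , r≤1) σ linear x≺y y≺z =
    <⇒≱ (≤-<-trans (≤-trans (s≤s z≤n) (strict x≺y)) (strict y≺z)) (r≤1 _)
    where
    strict : ∀ {x y} → x ≺ y → r x < r y
    strict = rank-strictlyMonotone (λ x → toℕ (σ ⟨$⟩ˡ x)) (position-strictlyMonotone σ linear) r r-cover

  noChain⇒IsIC : (∀ {x y z} → x ≺ y → ¬ y ≺ z) → ∀ I → IsIC P I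
  noChain⇒IsIC no-chain I x y z x∈I y∈I x≼z z≼y with z ≟ x | z ≟ y
  ... | yes refl | _        = x∈I
  ... | no _     | yes refl = y∈I
  ... | no z≢x   | no z≢y   = ⊥-elim (no-chain (x≼z , λ x≡z → z≢x (sym x≡z)) (z≼y , z≢y))

  toggle≡flip : ∀ {x I} → IsIC P (flip P x I) → toggle P x I ≡ flip P x I
  toggle≡flip {x} {I} flipIC with isIC? P (flip P x I)
  ... | yes _    = refl
  ... | no ¬flip = ⊥-elim (¬flip flipIC)

  module _ (allIC : ∀ I → IsIC P I) where

    toggle≡flipEverywhere : ∀ x I → toggle P x I ≡ flip P x I
    toggle≡flipEverywhere x I = toggle≡flip (allIC (flip P x I))

    lookup-toggleSeq-∉ : ∀ {j} ys I → All (j ≢_) ys → lookup (toggleSeq P ys I) j ≡ lookup I j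
    lookup-toggleSeq-∉ []       I _               = refl
    lookup-toggleSeq-∉ {j} (y ∷ ys) I (j≢y ∷ j∉ys) = begin
      lookup (toggle P y (toggleSeq P ys I)) j ≡⟨ cong (λ J → lookup J j) (toggle≡flipEverywhere y (toggleSeq P ys I)) ⟩
      lookup (flip P y (toggleSeq P ys I)) j   ≡⟨ lookup∘updateAt′ j y j≢y (toggleSeq P ys I) ⟩
      lookup (toggleSeq P ys I) j              ≡⟨ lookup-toggleSeq-∉ ys I j∉ys ⟩
      lookup I j                               ∎

    lookup-toggleSeq-∈ : ∀ {j} ys I → Unique ys → j ∈ ys → lookup (toggleSeq P ys I) j ≡ not (lookup I j)
    lookup-toggleSeq-∈ {j} (y ∷ ys) I (y∉ys ∷ unique) j∈y∷ys = begin
      lookup (toggle P y (toggleSeq P ys I)) j ≡⟨ cong (λ J → lookup J j) (toggle≡flipEverywhere y (toggleSeq P ys I)) ⟩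
      lookup (flip P y (toggleSeq P ys I)) j   ≡⟨ flipped j∈y∷ys ⟩
      not (lookup I j)                         ∎
      where
      flipped : j ∈ y ∷ ys → lookup (flip P y (toggleSeq P ys I)) j ≡ not (lookup I j)
      flipped (here refl) = trans (lookup∘updateAt j (toggleSeq P ys I)) (cong not (lookup-toggleSeq-∉ ys I y∉ys))
      flipped (there j∈ys) = trans (lookup∘updateAt′ j y (λ j≡y → All.lookup y∉ys j∈ys (sym j≡y)) (toggleSeq P ys I))
                                   (lookup-toggleSeq-∈ ys I unique j∈ys)

    Row≡∁ : ∀ σ I → Row P σ I ≡ ∁ I
    Row≡∁ σ I = begin
      Row P σ I                           ≡⟨ sym (tabulate∘lookup (Row P σ I)) ⟩
      tabulate (lookup (Row P σ I))       ≡⟨ tabulate-cong (λ j → lookup-toggleSeq-∈ order I unique (listed j)) ⟩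
      tabulate (λ j → not (lookup I j))   ≡⟨ tabulate-cong (λ j → sym (lookup-map j not I)) ⟩
      tabulate (lookup (∁ I))             ≡⟨ tabulate∘lookup (∁ I) ⟩
      ∁ I                                 ∎
      where
      order : List (Fin n)
      order = map (σ ⟨$⟩ʳ_) (allFin n)
      unique : Unique order
      unique = map⁺ (λ σi≡σj → trans (sym (inverseˡ σ)) (trans (cong (σ ⟨$⟩ˡ_) σi≡σj) (inverseˡ σ))) (allFin⁺ n)
      listed : ∀ j → j ∈ order
      listed j = subst (_∈ order) (inverseʳ σ) (∈-map⁺ (σ ⟨$⟩ʳ_) (∈-allFin (σ ⟨$⟩ˡ j)))

    Row-involutive : ∀ σ I → Row P σ (Row P σ I) ≡ I
    Row-involutive σ I = begin
      Row P σ (Row P σ I) ≡⟨ cong (Row P σ) (Row≡∁ σ I) ⟩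
      Row P σ (∁ I)       ≡⟨ Row≡∁ σ (∁ I) ⟩
      ∁ (∁ I)             ≡⟨ ∁-involutive I ⟩
      I                   ∎

    Row-fixedPointFree : .{{_ : NonZero n}} → ∀ σ I → Row P σ I ≢ I
    Row-fixedPointFree σ I Row≡I = ∁-fixedPointFree I (trans (sym (Row≡∁ σ I)) Row≡I)

module _ {A : Set} (f : A → A) (involutive : ∀ a → f (f a) ≡ a) (fixedPointFree : ∀ a → f a ≢ a) where

  involution-orbitSize : ∀ a → OrbitSize f a 2
  involution-orbitSize a = s≤s z≤n , involutive a , λ
    { 1 _ _ → fixedPointFree a
    ; (suc (suc j)) _ (s≤s (s≤s ())) }

  involution-hasOrder2 : (D : A → Set) → ∃ D → HasOrderOn D f 2
  involution-hasOrder2 D (a , Da) =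
    (λ b _ → 2 , involution-orbitSize b , ∣-refl) ,
    (λ m orbitSizes∣m → orbitSizes∣m a 2 Da (involution-orbitSize a))

lemma2p12 : (n : ℕ) → .{{_ : NonZero n}} → (P : FinPoset n)
    → RankedOfRankAtMostOne P
    → (σ : Permutation′ n) → IsLinearExtension P σ
    → ((I : Subset n) → IsIC P I → Row P σ I ≡ ∁ I)
      × HasOrderOn (IsIC P) (Row P σ) 2
lemma2p12 n P ranked σ linear =
  (λ I _ → Row≡∁ P allIC σ I) ,
  involution-hasOrder2 (Row P σ) (Row-involutive P allIC σ) (Row-fixedPointFree P allIC σ)
    (IsIC P) (⊥ , allIC ⊥)
  where
  allIC : ∀ I → IsIC P I
  allIC = noChain⇒IsIC P (rankAtMostOne⇒noChain P ranked σ linear)
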